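{- Assume every type satisfies $c_i\ge\theta T$. For every $i$ for which Algorithm DP computes $f_i$, we have $f_i\le\hat f_{i\delta T}$, where $\hat f_c=\max\{w:OPT_w\le c\}$; consequently $OPT_{f_i}\le i\delta T$.
   Context: Fix integers $n\ge1$, $W\ge1$ and $\epsilon\in(0,1)$. There are $n$ item types; type $i$ has deterministic cost $c_i>0$ and random weight $X_i$ with distribution supported in $\{1,\dots,W\}$ (standing assumption). Let $d_i(k)=\Pr[X_i=k]$. Set $OPT_w=0$ for integers $w\le0$ and $OPT_w=\min_j\big(c_j+\sum_{k=1}^W d_j(k)OPT_{w-k}\big)$ for $1\le w\le W$ (the minimum expected cost of adaptively inserting items, infinitely many of each type with independent weights revealed on insertion, until total weight at least $w$); $OPT_w$ is non-decreasing in $w$. Let $\bar E[X_i]=\sum_{j=1}^Wd_i(j)2^{\lfloor\log_2j\rfloor}$, $T=\frac W2\min_i\frac{c_i}{\bar E[X_i]}$, $\theta=\frac\epsilon{10n}$, $\delta=\frac{\epsilon^2}{100n}$. Algorithm DP: $f_0=0$; for $i=1,2,\dots,\lceil1/\delta\rceil+1$: define for integers $w\ge1$: $g_w=j\delta T$ if $f_{j-1}<w\le f_j$ for some $1\le j\le i-1$, and $g_w=i\delta T$ if $w>f_{i-1}$; let $f_i=\max\{w'\in\{0,\dots,W\}:\exists k,\ c_k+\sum_{j=1}^{w'-1}d_k(w'-j)g_j\le i\delta T\}$ (with $f_i=0$ if no such $w'$ exists); stop as soon as $f_i\ge W$.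
   Formalization: The costs $c_i$, the probabilities $d_i(k)$ and the parameter $\epsilon$ are taken to be rational numbers. -}

module Defs where

open import Data.Nat as ℕ using (ℕ; zero; suc; _∸_; _^_)
open import Data.Nat.Logarithm using (⌊log₂_⌋)
open import Data.Integer as ℤ using (ℤ; +_)
open import Data.Rational using (ℚ; 0ℚ; 1ℚ; _+_; _*_; _÷_; _⊓_; _/_; ≢-nonZero; ceiling)
open import Data.Rational.Properties using (_≟_; _≤?_)
open import Data.Fin using (Fin)
import Data.Fin as F
open import Data.Bool using (Bool; true; false; if_then_else_; _∧_; _∨_)
open import Data.List using (List; []; _∷_)
open import Data.Maybe using (Maybe; just; nothing)
open import Relation.Nullary using (yes; no; does)

ℕ→ℚ : ℕ → ℚ
ℕ→ℚ k = + k / 1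

-- division of rationals; only ever applied to nonzero divisors
-- (division by 0 is given the junk value 0)
_÷'_ : ℚ → ℚ → ℚ
p ÷' q with q ≟ 0ℚ
... | yes _ = 0ℚ
... | no q≢0 = _÷_ p q {{≢-nonZero q≢0}}

sumTo : ℕ → (ℕ → ℚ) → ℚ
sumTo zero f = 0ℚ
sumTo (suc m) f = sumTo m f + f (suc m)

-- minimum of f over Fin n (n ≥ 1 in all uses; junk 0 for n = 0)
minFin : (n : ℕ) → (Fin n → ℚ) → ℚ
minFin zero f = 0ℚ
minFin (suc zero) f = f F.zero
minFin (suc (suc m)) f = f F.zero ⊓ minFin (suc m) (λ x → f (F.suc x))

anyFin : (n : ℕ) → (Fin n → Bool) → Bool
anyFin zero P = false
anyFin (suc m) P = P F.zero ∨ anyFin m (λ x → P (F.suc x))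

lookupℚ : ℕ → List ℚ → ℚ
lookupℚ _ [] = 0ℚ
lookupℚ zero (x ∷ _) = x
lookupℚ (suc k) (_ ∷ xs) = lookupℚ k xs

lookupℕ : ℕ → List ℕ → ℕ
lookupℕ _ [] = 0
lookupℕ zero (x ∷ _) = x
lookupℕ (suc k) (_ ∷ xs) = lookupℕ k xs

_≤ᵇ_ : ℚ → ℚ → Bool
p ≤ᵇ q = does (p ≤? q)

-- An instance: n types, max weight W, costs c, distributions d (d i k = Pr[X_i = k]),
-- accuracy ε.
module Instance (n W : ℕ) (c : Fin n → ℚ) (d : Fin n → ℕ → ℚ) (ε : ℚ) where

  -- optList w = [OPT_w, OPT_{w-1}, ..., OPT_0];  entries beyond the list (w ≤ 0) are 0
  optList : ℕ → List ℚ
  optList zero = 0ℚ ∷ []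
  optList (suc w) =
    minFin n (λ j → c j + sumTo W (λ k → d j k * lookupℚ (k ∸ 1) prev)) ∷ prev
    where prev = optList w

  -- OPT_w  (OPT_{w} = min_j (c_j + Σ_{k=1}^W d_j(k) OPT_{w-k}), OPT_{≤0} = 0)
  OPT : ℕ → ℚ
  OPT w = lookupℚ 0 (optList w)

  hatfUpTo : ℚ → ℕ → ℕ
  hatfUpTo C zero = 0
  hatfUpTo C (suc w) = if OPT (suc w) ≤ᵇ C then suc w else hatfUpTo C w

  hatf : ℚ → ℕ
  hatf C = hatfUpTo C W

  Ebar : Fin n → ℚ
  Ebar i = sumTo W (λ j → d i j * ℕ→ℚ (2 ^ ⌊log₂ j ⌋))

  T : ℚ
  T = (ℕ→ℚ W ÷' ℕ→ℚ 2) * minFin n (λ i → c i ÷' Ebar i)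

  θ : ℚ
  θ = ε ÷' ℕ→ℚ (10 ℕ.* n)

  δ : ℚ
  δ = (ε * ε) ÷' ℕ→ℚ (100 ℕ.* n)

  level : ℕ → ℚ
  level i = ℕ→ℚ i * (δ * T)

  maxIter : ℤ
  maxIter = ceiling (1ℚ ÷' δ) ℤ.+ + 1

  gSearch : (ℕ → ℕ) → ℕ → ℕ → ℕ → Maybe ℕ
  gSearch Fs w zero j = nothing
  gSearch Fs w (suc fuel) j =
    if (Fs (j ∸ 1) ℕ.<ᵇ w) ∧ (w ℕ.≤ᵇ Fs j) then just j else gSearch Fs w fuel (suc j)

  -- g_w in iteration i, given f_0,…,f_{i-1} as Fs
  g : (ℕ → ℕ) → ℕ → ℕ → ℚ
  g Fs i w with gSearch Fs w (i ∸ 1) 1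
  ... | just j = level j
  ... | nothing = level i

  cond : (ℕ → ℕ) → ℕ → ℕ → Bool
  cond Fs i w' =
    anyFin n (λ k → (c k + sumTo (w' ∸ 1) (λ j → d k (w' ∸ j) * g Fs i j)) ≤ᵇ level i)

  bestUpTo : (ℕ → ℕ) → ℕ → ℕ → ℕ
  bestUpTo Fs i zero = 0
  bestUpTo Fs i (suc m) = if cond Fs i (suc m) then suc m else bestUpTo Fs i m

  -- fList i = [f_i, f_{i-1}, …, f_0]
  fList : ℕ → List ℕ
  fList zero = 0 ∷ []
  fList (suc i) = bestUpTo (λ j → lookupℕ (i ∸ j) prev) (suc i) W ∷ prev
    where prev = fList i

  -- f_i as computed by Algorithm DP (ignoring the stopping rule)
  f : ℕ → ℕ
  f i = lookupℕ 0 (fList i)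

-- By strong induction on i we show OPT_{f_j} ≤ jδT for every j. In iteration i the guess g_w is
-- jδT for the first j < i with w ≤ f_j, which dominates OPT_w because OPT is monotone and
-- OPT_{f_j} ≤ jδT; for all other w it is the current level L = iδT. Suppose f_i = w + 1 were
-- accepted through type k while OPT_{w+1} > L. Then OPT_j ≤ g_j + (OPT_{w+1} − L)·[g_j = L] for
-- j ≤ w, and plugging this into the Bellman recurrence OPT_{w+1} ≤ c_k + Σ d_k(w+1−j) OPT_j and
-- comparing with the acceptance test c_k + Σ d_k(w+1−j) g_j ≤ L forces c_k ≤ 0. So
-- OPT_{f_i} ≤ L, and f_i ≤ f̂_L is then the maximality of f̂_L.
module Submission where

open import Defs
open import Data.Nat as N using (ℕ; zero; suc; _∸_; _≤_; _<_; s≤s; z≤n; _≤′_; ≤′-refl; ≤′-step)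
import Data.Nat.Properties as NP
open import Data.Nat.Induction using (<-rec)
open import Data.Nat.Logarithm using (⌊log₂_⌋)
open import Data.Rational using (ℚ; 0ℚ; 1ℚ; _+_; _*_; _-_; -_; 1/_; nonNegative; positive; ≢-nonZero)
  renaming (_≤_ to _≤ℚ_; _<_ to _<ℚ_)
open import Data.Rational.Properties hiding (≤ᵇ⇒≤)
open import Data.Rational.Solver using (module +-*-Solver)
open +-*-Solver using (solve; con; _:+_; _:*_; :-_; _:=_)
open import Data.Fin using (Fin)
import Data.Fin as F
open import Data.Bool using (Bool; true; false; T; _∧_; if_then_else_)
open import Data.Bool.Properties using (T-∨; T-∧)
open import Data.Unit using (tt)
open import Data.Maybe using (Maybe; just; nothing)
open import Data.Product using (_×_; _,_; ∃; proj₁; proj₂)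
open import Data.Sum using (_⊎_; inj₁; inj₂; map₂)
open import Function.Bundles using (Equivalence)
open import Relation.Nullary using (Dec; does; _because_; yes; no; contradiction)
open import Relation.Nullary.Reflects using (invert)
open import Relation.Binary.PropositionalEquality

sumTo-cong : ∀ m {F G : ℕ → ℚ} → (∀ j → 1 ≤ j → j ≤ m → F j ≡ G j) → sumTo m F ≡ sumTo m G
sumTo-cong zero h = refl
sumTo-cong (suc m) h =
  cong₂ _+_ (sumTo-cong m (λ j 1≤j j≤m → h j 1≤j (NP.m≤n⇒m≤1+n j≤m))) (h (suc m) (s≤s z≤n) NP.≤-refl)

sumTo-mono : ∀ m {F G : ℕ → ℚ} → (∀ j → 1 ≤ j → j ≤ m → F j ≤ℚ G j) → sumTo m F ≤ℚ sumTo m G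
sumTo-mono zero h = ≤-refl
sumTo-mono (suc m) h =
  +-mono-≤ (sumTo-mono m (λ j 1≤j j≤m → h j 1≤j (NP.m≤n⇒m≤1+n j≤m))) (h (suc m) (s≤s z≤n) NP.≤-refl)

sumTo-zero : ∀ m → sumTo m (λ _ → 0ℚ) ≡ 0ℚ
sumTo-zero zero = refl
sumTo-zero (suc m) = cong (_+ 0ℚ) (sumTo-zero m)

sumTo-nonneg : ∀ m {F : ℕ → ℚ} → (∀ j → 1 ≤ j → j ≤ m → 0ℚ ≤ℚ F j) → 0ℚ ≤ℚ sumTo m F
sumTo-nonneg m {F} h = subst (_≤ℚ sumTo m F) (sumTo-zero m) (sumTo-mono m h)

sumTo-+ : ∀ m (F G : ℕ → ℚ) → sumTo m (λ j → F j + G j) ≡ sumTo m F + sumTo m G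
sumTo-+ zero F G = refl
sumTo-+ (suc m) F G rewrite sumTo-+ m F G =
  solve 4 (λ a b x y → (a :+ b) :+ (x :+ y) := (a :+ x) :+ (b :+ y)) refl
    (sumTo m F) (sumTo m G) (F (suc m)) (G (suc m))

sumTo-*ˡ : ∀ m a (F : ℕ → ℚ) → sumTo m (λ j → a * F j) ≡ a * sumTo m F
sumTo-*ˡ zero a F = sym (*-zeroʳ a)
sumTo-*ˡ (suc m) a F rewrite sumTo-*ˡ m a F = sym (*-distribˡ-+ a (sumTo m F) (F (suc m)))

sumTo-suc-shift : ∀ m (F : ℕ → ℚ) → sumTo (suc m) F ≡ F 1 + sumTo m (λ j → F (suc j))
sumTo-suc-shift zero F = trans (+-identityˡ (F 1)) (sym (+-identityʳ (F 1)))
sumTo-suc-shift (suc m) F rewrite sumTo-suc-shift m F = +-assoc (F 1) _ _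

sumTo-reverse : ∀ m (F : ℕ → ℚ) → sumTo m F ≡ sumTo m (λ j → F (suc m ∸ j))
sumTo-reverse zero F = refl
sumTo-reverse (suc m) F = begin
  sumTo m F + F (suc m)                                   ≡⟨ cong (_+ F (suc m)) (sumTo-reverse m F) ⟩
  sumTo m (λ j → F (suc m ∸ j)) + F (suc m)               ≡⟨ +-comm _ (F (suc m)) ⟩
  F (suc m) + sumTo m (λ j → F (suc m ∸ j))               ≡⟨ sumTo-suc-shift m (λ j → F (suc (suc m) ∸ j)) ⟨
  sumTo (suc m) (λ j → F (suc (suc m) ∸ j))               ∎
  where open ≡-Reasoning

sumTo-truncate : ∀ {w} W (F : ℕ → ℚ) → w ≤ W → (∀ m → w < m → m ≤ W → F m ≡ 0ℚ) →
                 sumTo W F ≡ sumTo w F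
sumTo-truncate {w} W F w≤W vanish with NP.m≤n⇒m<n∨m≡n w≤W
sumTo-truncate     W       F w≤W vanish | inj₂ refl = refl
sumTo-truncate {w} (suc W) F w≤W vanish | inj₁ (s≤s w≤W′) = begin
  sumTo W F + F (suc W) ≡⟨ cong₂ _+_ (sumTo-truncate W F w≤W′ (λ m w<m m≤W → vanish m w<m (NP.m≤n⇒m≤1+n m≤W)))
                                     (vanish (suc W) (s≤s w≤W′) NP.≤-refl) ⟩
  sumTo w F + 0ℚ        ≡⟨ +-identityʳ (sumTo w F) ⟩
  sumTo w F             ∎
  where open ≡-Reasoning

minFin-≤ : ∀ n (F : Fin n → ℚ) j → minFin n F ≤ℚ F j
minFin-≤ (suc zero) F F.zero = ≤-refl
minFin-≤ (suc (suc m)) F F.zero = p⊓q≤p (F F.zero) _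
minFin-≤ (suc (suc m)) F (F.suc j) = ≤-trans (p⊓q≤q (F F.zero) _) (minFin-≤ (suc m) (λ x → F (F.suc x)) j)

minFin-mono : ∀ n {F G : Fin n → ℚ} → (∀ j → F j ≤ℚ G j) → minFin n F ≤ℚ minFin n G
minFin-mono zero h = ≤-refl
minFin-mono (suc zero) h = h F.zero
minFin-mono (suc (suc m)) h = ⊓-mono-≤ (h F.zero) (minFin-mono (suc m) (λ x → h (F.suc x)))

minFin-nonneg : ∀ n {F : Fin n → ℚ} → (∀ j → 0ℚ ≤ℚ F j) → 0ℚ ≤ℚ minFin n F
minFin-nonneg zero h = ≤-refl
minFin-nonneg (suc zero) h = h F.zero
minFin-nonneg (suc (suc m)) h = ⊓-glb (h F.zero) (minFin-nonneg (suc m) (λ x → h (F.suc x)))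

anyFin-witness : ∀ n {P : Fin n → Bool} → T (anyFin n P) → ∃ λ k → T (P k)
anyFin-witness (suc m) any with Equivalence.to T-∨ any
... | inj₁ here = F.zero , here
... | inj₂ there with anyFin-witness m there
...   | k , hit = F.suc k , hit

T-does⇒ : ∀ {A : Set} (a? : Dec A) → T (does a?) → A
T-does⇒ (true because [a]) _ = invert [a]

≤ᵇ⇒≤ : ∀ {p q} → T (p ≤ᵇ q) → p ≤ℚ q
≤ᵇ⇒≤ {p} {q} = T-does⇒ (p ≤? q)

ℕ→ℚ-nonneg : ∀ k → 0ℚ ≤ℚ ℕ→ℚ k
ℕ→ℚ-nonneg k = nonNegative⁻¹ (ℕ→ℚ k) {{normalize-nonNeg k 1}}

*-nonneg : ∀ {p q} → 0ℚ ≤ℚ p → 0ℚ ≤ℚ q → 0ℚ ≤ℚ p * q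
*-nonneg {p} {q} 0≤p 0≤q = nonNegative⁻¹ _ {{nonNeg*nonNeg⇒nonNeg p {{nonNegative 0≤p}} q {{nonNegative 0≤q}}}}

÷'-nonneg : ∀ {p q} → 0ℚ ≤ℚ p → 0ℚ ≤ℚ q → 0ℚ ≤ℚ p ÷' q
÷'-nonneg {p} {q} 0≤p 0≤q with q ≟ 0ℚ
... | yes _ = ≤-refl
... | no q≢0 = *-nonneg 0≤p (nonNegative⁻¹ 1/q {{pos⇒nonNeg 1/q {{1/pos⇒pos q {{q>0}}}}}})
  where
  q>0 = nonNeg∧nonZero⇒pos q {{nonNegative 0≤q}} {{≢-nonZero q≢0}}
  1/q = (1/ q) {{pos⇒nonZero q {{q>0}}}}

*-monoˡ-≤ : ∀ r {p q} → 0ℚ ≤ℚ r → p ≤ℚ q → r * p ≤ℚ r * q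
*-monoˡ-≤ r 0≤r = *-monoˡ-≤-nonNeg r {{nonNegative 0≤r}}

+-cancelˡ-≤ : ∀ r {p q} → r + p ≤ℚ r + q → p ≤ℚ q
+-cancelˡ-≤ r {p} {q} h = subst₂ _≤ℚ_ (cancel p) (cancel q) (+-monoʳ-≤ (- r) h)
  where
  cancel : ∀ x → (- r) + (r + x) ≡ x
  cancel x = solve 2 (λ r x → (:- r) :+ (r :+ x) := x) refl r x

-- If x exceeded L by t > 0, the first inequality would give t ≤ t E, so E ≥ 1, and then
-- L ≤ L E ≤ B ≤ L − c.
≤-from-excess : ∀ {c x L B E} → 0ℚ <ℚ c → 0ℚ ≤ℚ L →
                x ≤ℚ c + (B + (x - L) * E) → c + B ≤ℚ L → L * E ≤ℚ B → x ≤ℚ L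
≤-from-excess {c} {x} {L} {B} {E} c>0 L≥0 x≤ cB≤L LE≤B with x ≤? L
... | yes x≤L = x≤L
... | no x≰L = contradiction (<-≤-trans c>0 c≤0) (<-irrefl refl)
  where
  t = x - L
  x≡L+t : x ≡ L + t
  x≡L+t = solve 2 (λ x L → x := L :+ (x :+ (:- L))) refl x L
  t>0 : 0ℚ <ℚ t
  t>0 = subst (_<ℚ t) (+-inverseʳ L) (+-monoˡ-< (- L) (≰⇒> x≰L))
  t≤tE : t * 1ℚ ≤ℚ t * E
  t≤tE = subst (_≤ℚ t * E) (sym (*-identityʳ t)) (+-cancelˡ-≤ L (begin
    L + t                ≡⟨ x≡L+t ⟨
    x                    ≤⟨ x≤ ⟩
    c + (B + t * E)      ≡⟨ +-assoc c B (t * E) ⟨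
    c + B + t * E        ≤⟨ +-monoˡ-≤ (t * E) cB≤L ⟩
    L + t * E            ∎))
    where open ≤-Reasoning
  c≤0 : c ≤ℚ 0ℚ
  c≤0 = +-cancelˡ-≤ B (begin
    B + c                ≡⟨ +-comm B c ⟩
    c + B                ≤⟨ cB≤L ⟩
    L                    ≡⟨ *-identityʳ L ⟨
    L * 1ℚ               ≤⟨ *-monoˡ-≤ L L≥0 (*-cancelˡ-≤-pos t {{positive t>0}} t≤tE) ⟩
    L * E                ≤⟨ LE≤B ⟩
    B                    ≡⟨ +-identityʳ B ⟨
    B + 0ℚ               ∎)
    where open ≤-Reasoning

≤-from-guesses : ∀ m (a o g : ℕ → ℚ) {c x L} → 0ℚ <ℚ c → 0ℚ ≤ℚ L →
  (∀ j → 1 ≤ j → j ≤ m → 0ℚ ≤ℚ a j) →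
  (∀ j → 1 ≤ j → j ≤ m → 0ℚ ≤ℚ g j) →
  (∀ j → 1 ≤ j → j ≤ m → o j ≤ℚ g j ⊎ (g j ≡ L × o j ≤ℚ x)) →
  x ≤ℚ c + sumTo m (λ j → a j * o j) →
  c + sumTo m (λ j → a j * g j) ≤ℚ L →
  x ≤ℚ L
≤-from-guesses m a o g {c} {x} {L} c>0 L≥0 a≥0 g≥0 guess x≤ accepted =
  ≤-from-excess c>0 L≥0 x≤c+B+tE accepted LE≤B
  where
  open ≤-Reasoning
  t = x - L
  indicator : ∀ {j} → Dec (o j ≤ℚ g j) → ℚ
  indicator (yes _) = 0ℚ
  indicator (no _) = 1ℚ
  e ag ae : ℕ → ℚ
  e j = indicator (o j ≤? g j)
  ag j = a j * g j
  ae j = a j * e j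

  o≤g+te′ : ∀ j → 1 ≤ j → j ≤ m → (o≤?g : Dec (o j ≤ℚ g j)) → o j ≤ℚ g j + t * indicator o≤?g
  o≤g+te′ j _ _ (yes o≤g) = ≤-trans o≤g (≤-reflexive (sym (trans (cong (g j +_) (*-zeroʳ t)) (+-identityʳ (g j)))))
  o≤g+te′ j 1≤j j≤m (no o≰g) with guess j 1≤j j≤m
  ... | inj₁ o≤g = contradiction o≤g o≰g
  ... | inj₂ (g≡L , o≤x) = ≤-trans o≤x (≤-reflexive (begin-equality
    x               ≡⟨ solve 2 (λ x L → x := L :+ (x :+ (:- L)) :* con 1ℚ) refl x L ⟩
    L + t * 1ℚ      ≡⟨ cong (λ h → h + t * 1ℚ) g≡L ⟨
    g j + t * 1ℚ    ∎))

  Le≤g′ : ∀ j → 1 ≤ j → j ≤ m → (o≤?g : Dec (o j ≤ℚ g j)) → L * indicator o≤?g ≤ℚ g j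
  Le≤g′ j 1≤j j≤m (yes _) = subst (_≤ℚ g j) (sym (*-zeroʳ L)) (g≥0 j 1≤j j≤m)
  Le≤g′ j 1≤j j≤m (no o≰g) with guess j 1≤j j≤m
  ... | inj₁ o≤g = contradiction o≤g o≰g
  ... | inj₂ (g≡L , _) = ≤-reflexive (trans (*-identityʳ L) (sym g≡L))

  x≤c+B+tE : x ≤ℚ c + (sumTo m ag + t * sumTo m ae)
  x≤c+B+tE = begin
    x                                          ≤⟨ x≤ ⟩
    c + sumTo m (λ j → a j * o j)              ≤⟨ +-monoʳ-≤ c (sumTo-mono m (λ j 1≤j j≤m →
                                                    *-monoˡ-≤ (a j) (a≥0 j 1≤j j≤m) (o≤g+te′ j 1≤j j≤m (o j ≤? g j)))) ⟩
    c + sumTo m (λ j → a j * (g j + t * e j))  ≡⟨ cong (c +_) (sumTo-cong m (λ j _ _ →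
                                                    solve 4 (λ a g t e → a :* (g :+ t :* e) := a :* g :+ t :* (a :* e))
                                                      refl (a j) (g j) t (e j))) ⟩
    c + sumTo m (λ j → ag j + t * ae j)        ≡⟨ cong (c +_) (sumTo-+ m ag (λ j → t * ae j)) ⟩
    c + (sumTo m ag + sumTo m (λ j → t * ae j)) ≡⟨ cong (λ s → c + (sumTo m ag + s)) (sumTo-*ˡ m t ae) ⟩
    c + (sumTo m ag + t * sumTo m ae)          ∎

  LE≤B : L * sumTo m ae ≤ℚ sumTo m ag
  LE≤B = begin
    L * sumTo m ae               ≡⟨ sumTo-*ˡ m L ae ⟨
    sumTo m (λ j → L * ae j)     ≤⟨ sumTo-mono m (λ j 1≤j j≤m → ≤-trans
                                      (≤-reflexive (solve 3 (λ L a e → L :* (a :* e) := a :* (L :* e)) refl L (a j) (e j)))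
                                      (*-monoˡ-≤ (a j) (a≥0 j 1≤j j≤m) (Le≤g′ j 1≤j j≤m (o j ≤? g j)))) ⟩
    sumTo m ag                   ∎

module Analysis (n W : ℕ) (c : Fin n → ℚ) (d : Fin n → ℕ → ℚ) (ε : ℚ)
  (ε≥0 : 0ℚ ≤ℚ ε)
  (c>0 : ∀ i → 0ℚ <ℚ c i)
  (d≥0 : ∀ i k → 1 ≤ k → k ≤ W → 0ℚ ≤ℚ d i k) where

  open Instance n W c d ε renaming (T to scale)

  optList-nonneg : ∀ w m → 0ℚ ≤ℚ lookupℚ m (optList w)
  optList-nonneg zero zero = ≤-refl
  optList-nonneg zero (suc m) = ≤-refl
  optList-nonneg (suc w) zero = minFin-nonneg n (λ j → +-mono-≤ (<⇒≤ (c>0 j))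
    (sumTo-nonneg W (λ k 1≤k k≤W → *-nonneg (d≥0 j k 1≤k k≤W) (optList-nonneg w (k ∸ 1)))))
  optList-nonneg (suc w) (suc m) = optList-nonneg w m

  optList-mono : ∀ w m → lookupℚ m (optList w) ≤ℚ lookupℚ m (optList (suc w))
  optList-mono zero zero = optList-nonneg 1 0
  optList-mono zero (suc m) = optList-nonneg zero m
  optList-mono (suc w) zero = minFin-mono n (λ j → +-monoʳ-≤ (c j)
    (sumTo-mono W (λ k 1≤k k≤W → *-monoˡ-≤ (d j k) (d≥0 j k 1≤k k≤W) (optList-mono w (k ∸ 1)))))
  optList-mono (suc w) (suc m) = optList-mono w m

  optList-lookup : ∀ w m → lookupℚ m (optList w) ≡ OPT (w ∸ m)
  optList-lookup zero zero = refl
  optList-lookup zero (suc m) = refl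
  optList-lookup (suc w) zero = refl
  optList-lookup (suc w) (suc m) = optList-lookup w m

  OPT-mono : ∀ {u v} → u ≤ v → OPT u ≤ℚ OPT v
  OPT-mono u≤v = go (NP.≤⇒≤′ u≤v)
    where
    go : ∀ {u v} → u ≤′ v → OPT u ≤ℚ OPT v
    go ≤′-refl = ≤-refl
    go (≤′-step {v} u≤v) = ≤-trans (go u≤v) (optList-mono v 0)

  OPT-recurrence : ∀ {w} → w < W → ∀ k → OPT (suc w) ≤ℚ c k + sumTo w (λ j → d k (suc w ∸ j) * OPT j)
  OPT-recurrence {w} w<W k = ≤-trans (minFin-≤ n _ k) (≤-reflexive (cong (c k +_) reindex))
    where
    F : ℕ → ℚ
    F m = d k m * lookupℚ (m ∸ 1) (optList w)
    beyond-w : ∀ m → w < m → m ≤ W → F m ≡ 0ℚ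
    beyond-w m (s≤s w≤m-1) _ rewrite optList-lookup w (m ∸ 1) | NP.m≤n⇒m∸n≡0 w≤m-1 = *-zeroʳ (d k m)
    index : ∀ {j} → j ≤ w → w ∸ ((suc w ∸ j) ∸ 1) ≡ j
    index j≤w rewrite NP.+-∸-assoc 1 j≤w = NP.m∸[m∸n]≡n j≤w
    reindex : sumTo W F ≡ sumTo w (λ j → d k (suc w ∸ j) * OPT j)
    reindex = begin
      sumTo W F                         ≡⟨ sumTo-truncate W F (NP.<⇒≤ w<W) beyond-w ⟩
      sumTo w F                         ≡⟨ sumTo-reverse w F ⟩
      sumTo w (λ j → F (suc w ∸ j))     ≡⟨ sumTo-cong w (λ j _ j≤w → cong (d k (suc w ∸ j) *_)
                                             (trans (optList-lookup w _) (cong OPT (index j≤w)))) ⟩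
      sumTo w (λ j → d k (suc w ∸ j) * OPT j) ∎
      where open ≡-Reasoning

  level-nonneg : ∀ i → 0ℚ ≤ℚ level i
  level-nonneg i = *-nonneg (ℕ→ℚ-nonneg i) (*-nonneg δ≥0 scale≥0)
    where
    δ≥0 : 0ℚ ≤ℚ δ
    δ≥0 = ÷'-nonneg (*-nonneg ε≥0 ε≥0) (ℕ→ℚ-nonneg (100 N.* n))
    Ebar≥0 : ∀ i → 0ℚ ≤ℚ Ebar i
    Ebar≥0 i = sumTo-nonneg W (λ j 1≤j j≤W → *-nonneg (d≥0 i j 1≤j j≤W) (ℕ→ℚ-nonneg (2 N.^ ⌊log₂ j ⌋)))
    scale≥0 : 0ℚ ≤ℚ scale
    scale≥0 = *-nonneg (÷'-nonneg (ℕ→ℚ-nonneg W) (ℕ→ℚ-nonneg 2))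
                       (minFin-nonneg n (λ i → ÷'-nonneg (<⇒≤ (c>0 i)) (Ebar≥0 i)))

  fsBefore : ℕ → ℕ → ℕ
  fsBefore i j = lookupℕ (i ∸ j) (fList i)

  fsBefore-f : ∀ {i j} → j ≤ i → fsBefore i j ≡ f j
  fsBefore-f j≤i = go (NP.≤⇒≤′ j≤i)
    where
    go : ∀ {i j} → j ≤′ i → lookupℕ (i ∸ j) (fList i) ≡ f j
    go {i} ≤′-refl rewrite NP.n∸n≡0 i = refl
    go {suc i} (≤′-step j≤i) rewrite NP.+-∸-assoc 1 (NP.≤′⇒≤ j≤i) = go j≤i

  bestUpTo-elim : ∀ Fs i m (P : ℕ → Set) → P 0 →
                  (∀ {w} → suc w ≤ m → T (cond Fs i (suc w)) → P (suc w)) →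
                  P (bestUpTo Fs i m)
  bestUpTo-elim Fs i zero P p0 accept = p0
  bestUpTo-elim Fs i (suc m) P p0 accept = select (cond Fs i (suc m)) refl
    where
    select : ∀ b → cond Fs i (suc m) ≡ b → P (if b then suc m else bestUpTo Fs i m)
    select true accepted = accept NP.≤-refl (subst T (sym accepted) tt)
    select false _ = bestUpTo-elim Fs i m P p0 (λ sw≤m → accept (NP.m≤n⇒m≤1+n sw≤m))

  f≤W : ∀ i → f i ≤ W
  f≤W zero = z≤n
  f≤W (suc i) = bestUpTo-elim (fsBefore i) (suc i) W (_≤ W) z≤n (λ sw≤W _ → sw≤W)

  gSearch-found : ∀ Fs w fuel s {j} → gSearch Fs w fuel s ≡ just j → j < s N.+ fuel × w ≤ Fs j
  gSearch-found Fs w (suc fuel) s found with (Fs (s ∸ 1) N.<ᵇ w) ∧ (w N.≤ᵇ Fs s) in test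
  gSearch-found Fs w (suc fuel) s refl | true =
    NP.m<m+n s (s≤s z≤n) , NP.≤ᵇ⇒≤ w (Fs s) (proj₂ (Equivalence.to T-∧ (subst T (sym test) tt)))
  gSearch-found Fs w (suc fuel) s {j} found | false with gSearch-found Fs w fuel (suc s) found
  ... | j<1+s+fuel , w≤Fsj = subst (j <_) (sym (NP.+-suc s fuel)) j<1+s+fuel , w≤Fsj

  g-nonneg : ∀ Fs i w → 0ℚ ≤ℚ g Fs i w
  g-nonneg Fs i w with gSearch Fs w (i ∸ 1) 1
  ... | just j = level-nonneg j
  ... | nothing = level-nonneg i

  guessOf : ℕ → Maybe ℕ → ℚ
  guessOf i (just j) = level j
  guessOf i nothing = level i

  g-guessOf : ∀ Fs i w → g Fs i w ≡ guessOf i (gSearch Fs w (i ∸ 1) 1)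
  g-guessOf Fs i w with gSearch Fs w (i ∸ 1) 1
  ... | just _ = refl
  ... | nothing = refl

  g-guess : ∀ {i} → (∀ {j} → j < suc i → OPT (f j) ≤ℚ level j) →
            ∀ w → OPT w ≤ℚ g (fsBefore i) (suc i) w ⊎ g (fsBefore i) (suc i) w ≡ level (suc i)
  g-guess {i} IH w = subst (λ x → OPT w ≤ℚ x ⊎ x ≡ level (suc i)) (sym (g-guessOf (fsBefore i) (suc i) w))
                            (guess (gSearch (fsBefore i) w i 1) refl)
    where
    guess : ∀ r → gSearch (fsBefore i) w i 1 ≡ r → OPT w ≤ℚ guessOf (suc i) r ⊎ guessOf (suc i) r ≡ level (suc i)
    guess nothing _ = inj₂ refl
    guess (just j) found = inj₁ (≤-trans (OPT-mono w≤fj) (IH (proj₁ hit)))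
      where
      hit = gSearch-found (fsBefore i) w i 1 found
      w≤fj : w ≤ f j
      w≤fj = subst (w ≤_) (fsBefore-f (NP.≤-pred (proj₁ hit))) (proj₂ hit)

  accepted-≤-level : ∀ {i} → (∀ {j} → j < suc i → OPT (f j) ≤ℚ level j) →
                     ∀ {w} → suc w ≤ W → T (cond (fsBefore i) (suc i) (suc w)) → OPT (suc w) ≤ℚ level (suc i)
  accepted-≤-level {i} IH {w} sw≤W accepted =
    ≤-from-guesses w (λ j → d k (suc w ∸ j)) OPT (g (fsBefore i) (suc i)) (c>0 k) (level-nonneg (suc i))
      (λ j _ j≤w → d≥0 k (suc w ∸ j) (NP.m<n⇒0<n∸m (s≤s j≤w)) (NP.≤-trans (NP.m∸n≤m (suc w) j) sw≤W))
      (λ j _ _ → g-nonneg (fsBefore i) (suc i) j)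
      (λ j _ j≤w → map₂ (_, OPT-mono (NP.m≤n⇒m≤1+n j≤w)) (g-guess IH j))
      (OPT-recurrence sw≤W k)
      (≤ᵇ⇒≤ (proj₂ witness))
    where
    witness = anyFin-witness n accepted
    k = proj₁ witness

  OPT-f≤level : ∀ i → OPT (f i) ≤ℚ level i
  OPT-f≤level = <-rec (λ i → OPT (f i) ≤ℚ level i) step
    where
    step : ∀ i → (∀ {j} → j < i → OPT (f j) ≤ℚ level j) → OPT (f i) ≤ℚ level i
    step zero _ = level-nonneg 0
    step (suc i) IH = bestUpTo-elim (fsBefore i) (suc i) W (λ r → OPT r ≤ℚ level (suc i))
                        (level-nonneg (suc i)) (accepted-≤-level IH)

  hatfUpTo-maximal : ∀ C m {r} → r ≤ m → OPT r ≤ℚ C → r ≤ hatfUpTo C m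
  hatfUpTo-maximal C zero z≤n _ = z≤n
  hatfUpTo-maximal C (suc m) {r} r≤1+m OPTr≤C = select (OPT (suc m) ≤? C)
    where
    select : (OPT≤?C : Dec (OPT (suc m) ≤ℚ C)) → r ≤ (if does OPT≤?C then suc m else hatfUpTo C m)
    select (yes _) = r≤1+m
    select (no OPT≰C) with NP.m≤n⇒m<n∨m≡n r≤1+m
    ... | inj₂ refl = contradiction OPTr≤C OPT≰C
    ... | inj₁ (s≤s r≤m) = hatfUpTo-maximal C m r≤m OPTr≤C

-- Imported only here: its +_ would make sections of ℚ's _+_ ambiguous above.
open import Data.Integer as ℤ using (+_)

lemma2 : (n W : ℕ) → 1 ≤ n → 1 ≤ W →
  (ε : ℚ) → 0ℚ <ℚ ε → ε <ℚ 1ℚ →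
  (c : Fin n → ℚ) → (d : Fin n → ℕ → ℚ) →
  (∀ i → 0ℚ <ℚ c i) →
  (∀ i k → 1 ≤ k → k ≤ W → 0ℚ ≤ℚ d i k) →
  (∀ i → sumTo W (d i) ≡ 1ℚ) →
  (∀ i → Instance.θ n W c d ε * Instance.T n W c d ε ≤ℚ c i) →
  (i : ℕ) → 1 ≤ i → + i ℤ.≤ Instance.maxIter n W c d ε →
  (∀ j → 1 ≤ j → j < i → Instance.f n W c d ε j < W) →
  (Instance.f n W c d ε i ≤ Instance.hatf n W c d ε (Instance.level n W c d ε i))
    × (Instance.OPT n W c d ε (Instance.f n W c d ε i) ≤ℚ Instance.level n W c d ε i)
lemma2 n W _ _ ε ε>0 _ c d c>0 d≥0 _ _ i _ _ _ =
  hatfUpTo-maximal (level i) W (f≤W i) (OPT-f≤level i) , OPT-f≤level i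
  where
  open Analysis n W c d ε (<⇒≤ ε>0) c>0 d≥0
  open Instance n W c d ε using (level; f)
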